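{- Let $G$ be a finite hypergraph (not necessarily uniform, parallel edges allowed) with a fixed edge order $e_1,\dots,e_m$ and a leading vertex $x_i\in e_i$ chosen for each edge, and let $w_G$ be its weighting as defined below. If $G$ has minimum degree $\delta$, then $w_G(v)\ge\delta$ for every vertex $v$.
   Context: For such a hypergraph $F$ (with edges and leading vertices), $graph(F)$ is the directed graph on $V(F)$ containing, for each edge $e_i$ of $F$, the directed edges $x_i\to u$ for every $u\in e_i\setminus\{x_i\}$. Let $G_i$ be the hypergraph on $V(G)$ with edges $e_1,\dots,e_i$ (with their leading vertices). Define $w_{G_0}\equiv0$ and, for $1\le i\le m$, $w_{G_i}(x_i)=w_{G_{i-1}}(x_i)+1$ and for $v\ne x_i$: $w_{G_i}(v)=\max\{w_{G_i}(x_i),w_{G_{i-1}}(v)\}$ if there is a directed path from $x_i$ to $v$ in $graph(G_i)$, and $w_{G_i}(v)=w_{G_{i-1}}(v)$ otherwise. Set $w_G=w_{G_m}$. -}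

module Defs where

open import Data.Nat using (ℕ; zero; suc; _⊔_)
open import Data.Fin using (Fin)
open import Data.Fin.Subset using (Subset; _∈_)
open import Data.Fin.Subset.Properties using (_∈?_)
open import Data.List using (List; []; _∷_; _++_; [_]; length; filter)
import Data.List.Membership.Propositional as LM
open import Relation.Binary.PropositionalEquality using (_≡_; _≢_)
open import Relation.Nullary using (¬_)
open import Data.Product using (_×_; Σ)

record Edge (n : ℕ) : Set where
  constructor edge
  field
    leader : Fin n
    verts  : Subset n
    leader∈ : leader ∈ verts
open Edge public

Hypergraph : ℕ → Set
Hypergraph n = List (Edge n)

degree : ∀ {n} → Hypergraph n → Fin n → ℕ
degree G v = length (filter (λ e → v ∈? verts e) G)

HasMinDegree : ∀ {n} → Hypergraph n → ℕ → Set
HasMinDegree {n} G δ = (∀ (v : Fin n) → δ Data.Nat.≤ degree G v)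
                     × Σ (Fin n) (λ v → degree G v ≡ δ)

-- directed path from a to b in graph(F): arcs x_i → u for u ∈ e_i ∖ {x_i}
data Path {n} (F : Hypergraph n) : Fin n → Fin n → Set where
  here : ∀ {a} → Path F a a
  step : ∀ {a u b} (e : Edge n) → e LM.∈ F → leader e ≡ a →
         u ∈ verts e → u ≢ a → Path F u b → Path F a b

data Weighting {n} : Hypergraph n → (Fin n → ℕ) → Set where
  w-empty : Weighting [] (λ _ → 0)
  w-step  : ∀ {F w w'} (e : Edge n) → Weighting F w →
            w' (leader e) ≡ suc (w (leader e)) →
            (∀ v → v ≢ leader e → Path (F ++ [ e ]) (leader e) v →
                   w' v ≡ w' (leader e) ⊔ w v) →
            (∀ v → v ≢ leader e → ¬ Path (F ++ [ e ]) (leader e) v →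
                   w' v ≡ w v) →
            Weighting (F ++ [ e ]) w'

{-# OPTIONS --safe #-}
-- Induction along the edge order, with the invariant that every vertex v is
-- reachable in graph(G_i) from some vertex whose degree in G_i is at most
-- w_{G_i}(v).  Adding e_i raises the degree of its members by one; a member u
-- whose witness path ends at v is rerouted through the leader x_i, whose own
-- witness has degree at most w_{G_{i-1}}(x_i) = w_{G_i}(x_i) - 1, and
-- w_{G_i}(x_i) ≤ w_{G_i}(v) since x_i → u reaches v.  Minimum degree δ then
-- gives δ ≤ w_G(v).
module Submission where

open import Defs
open import Data.Nat using (ℕ; _≤_; suc; z≤n; s≤s; _⊔_; _≤?_)
open import Data.Nat.Properties using (≤-refl; ≤-reflexive; ≤-trans; n≤1+n; m≤m⊔n; m≤n⊔m)
open import Data.Fin using (Fin; _≟_)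
open import Data.Fin.Subset using (_∈_; _∉_)
open import Data.Fin.Subset.Properties using (_∈?_)
open import Data.List using ([]; _∷_; _++_; [_])
open import Data.List.Membership.Propositional.Properties using (∈-++⁺ˡ; ∈-++⁺ʳ)
open import Data.List.Relation.Unary.Any using (here)
open import Data.Product using (_×_; _,_; ∃-syntax)
open import Relation.Binary.PropositionalEquality using (_≡_; _≢_; refl; sym; cong; subst)
open import Relation.Nullary using (¬_; yes; no; contradiction)
open import Relation.Nullary.Decidable using (decidable-stable)

module _ {n : ℕ} where

  degree-++-≤ : ∀ (F : Hypergraph n) e u → degree (F ++ [ e ]) u ≤ suc (degree F u)
  degree-++-≤ [] e u with u ∈? verts e
  ... | yes _ = s≤s z≤n
  ... | no  _ = z≤n
  degree-++-≤ (f ∷ F) e u with u ∈? verts f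
  ... | yes _ = s≤s (degree-++-≤ F e u)
  ... | no  _ = degree-++-≤ F e u

  degree-++-∉ : ∀ (F : Hypergraph n) e {u} → u ∉ verts e → degree (F ++ [ e ]) u ≡ degree F u
  degree-++-∉ [] e {u} u∉ with u ∈? verts e
  ... | yes u∈ = contradiction u∈ u∉
  ... | no  _  = refl
  degree-++-∉ (f ∷ F) e {u} u∉ with u ∈? verts f
  ... | yes _ = cong suc (degree-++-∉ F e u∉)
  ... | no  _ = degree-++-∉ F e u∉

  Path-++ʳ : ∀ {F : Hypergraph n} e {a b} → Path F a b → Path (F ++ [ e ]) a b
  Path-++ʳ e here                   = here
  Path-++ʳ e (step f f∈ l u∈ u≢ p) = step f (∈-++⁺ˡ f∈) l u∈ u≢ (Path-++ʳ e p)

  Path-trans : ∀ {F : Hypergraph n} {a b c} → Path F a b → Path F b c → Path F a c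
  Path-trans here                  q = q
  Path-trans (step f f∈ l u∈ u≢ p) q = step f f∈ l u∈ u≢ (Path-trans p q)

  leader⇒member : ∀ (F : Hypergraph n) e {u} → u ∈ verts e → Path (F ++ [ e ]) (leader e) u
  leader⇒member F e {u} u∈ with u ≟ leader e
  ... | yes refl = here
  ... | no  u≢   = step e (∈-++⁺ʳ F (here refl)) refl u∈ u≢ here

  module WeightingStep
    {F : Hypergraph n} {e : Edge n} {w w′ : Fin n → ℕ}
    (w′-leader : w′ (leader e) ≡ suc (w (leader e)))
    (w′-reached : ∀ v → v ≢ leader e → Path (F ++ [ e ]) (leader e) v →
                  w′ v ≡ w′ (leader e) ⊔ w v)
    (w′-unreached : ∀ v → v ≢ leader e → ¬ Path (F ++ [ e ]) (leader e) v →
                    w′ v ≡ w v)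
    where

    -- Reachability from the leader is not decidable here, but the
    -- inequality is, so it suffices to refute its negation.
    weight-mono : ∀ v → w v ≤ w′ v
    weight-mono v with v ≟ leader e
    ... | yes refl = subst (w v ≤_) (sym w′-leader) (n≤1+n _)
    ... | no  v≢   = decidable-stable (w v ≤? w′ v) λ w≰ →
      w≰ (≤-reflexive (sym (w′-unreached v v≢ λ p →
        w≰ (subst (w v ≤_) (sym (w′-reached v v≢ p)) (m≤n⊔m _ _)))))

    leader-weight≤ : ∀ {v} → Path (F ++ [ e ]) (leader e) v → w′ (leader e) ≤ w′ v
    leader-weight≤ {v} p with v ≟ leader e
    ... | yes refl = ≤-refl
    ... | no  v≢   = subst (w′ (leader e) ≤_) (sym (w′-reached v v≢ p)) (m≤m⊔n _ _)

  ReachedFromLowDegree : Hypergraph n → (Fin n → ℕ) → Fin n → Set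
  ReachedFromLowDegree F w v = ∃[ u ] Path F u v × degree F u ≤ w v

  reachedFromLowDegree-trans : ∀ {F w a v} → ReachedFromLowDegree F w a →
    Path F a v → w a ≤ w v → ReachedFromLowDegree F w v
  reachedFromLowDegree-trans (u , p , d) q wa≤wv = u , Path-trans p q , ≤-trans d wa≤wv

  weighting⇒reachedFromLowDegree : ∀ {F w} → Weighting F w → ∀ v → ReachedFromLowDegree F w v
  weighting⇒reachedFromLowDegree w-empty v = v , here , z≤n
  weighting⇒reachedFromLowDegree {w = w′}
    (w-step {F} {w} e W w′-leader w′-reached w′-unreached) v
    with weighting⇒reachedFromLowDegree W v
  ... | u , p , d with u ∈? verts e
  ...   | no  u∉ = u , Path-++ʳ e p ,
                   subst (_≤ w′ v) (sym (degree-++-∉ F e u∉)) (≤-trans d (weight-mono v))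
    where open WeightingStep w′-leader w′-reached w′-unreached
  ...   | yes u∈ = reachedFromLowDegree-trans leader-reached leader⇝v (leader-weight≤ leader⇝v)
    where
    open WeightingStep w′-leader w′-reached w′-unreached
    leader⇝v : Path (F ++ [ e ]) (leader e) v
    leader⇝v = Path-trans (leader⇒member F e u∈) (Path-++ʳ e p)
    leader-reached : ReachedFromLowDegree (F ++ [ e ]) w′ (leader e)
    leader-reached with weighting⇒reachedFromLowDegree W (leader e)
    ... | u′ , p′ , d′ = u′ , Path-++ʳ e p′ ,
      ≤-trans (degree-++-≤ F e u′) (subst (suc (degree F u′) ≤_) (sym w′-leader) (s≤s d′))

lemma3p1 : ∀ {n} (G : Hypergraph n) (δ : ℕ) (w : Fin n → ℕ) →
    HasMinDegree G δ → Weighting G w → ∀ (v : Fin n) → δ ≤ w v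
lemma3p1 G δ w (δ≤degree , _) W v with weighting⇒reachedFromLowDegree W v
... | u , _ , degree≤w = ≤-trans (δ≤degree u) degree≤w
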